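{- $m_5(6)\geq 20$.
   Context: For $0\leq p<k$, $m_p(k)$ is the maximum, over all $k$-uniform intersecting families $\mathcal{G}$ (on an arbitrarily large ground set $[N]$) with covering number $\tau(\mathcal{G})=k$, of $\min\{|\{G\in\mathcal{G}:G\cap S=\emptyset\}|: S\subset[N],\ |S|=p\}$. Intersecting means any two members intersect; $\tau(\mathcal{G})$ is the minimum size of a set meeting every member. -}

module Defs where

open import Data.Nat using (ℕ; _≤_)
open import Data.Product using (Σ; _×_; ∃)
open import Data.List using (List; length; filter)
open import Data.List.Relation.Unary.All using (All)
open import Data.List.Membership.Propositional using (_∈_)
open import Data.Fin.Subset using (Subset; _∩_; ∣_∣; Nonempty)
open import Data.Fin.Subset.Properties using (nonempty?)
open import Relation.Nullary using (¬?)
open import Relation.Binary.PropositionalEquality using (_≡_)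

Family : ℕ → Set
Family N = List (Subset N)

Uniform : ∀ {N} → ℕ → Family N → Set
Uniform k 𝒢 = All (λ G → ∣ G ∣ ≡ k) 𝒢

Intersecting : ∀ {N} → Family N → Set
Intersecting 𝒢 = ∀ {G H} → G ∈ 𝒢 → H ∈ 𝒢 → Nonempty (G ∩ H)

IsCover : ∀ {N} → Family N → Subset N → Set
IsCover 𝒢 T = All (λ G → Nonempty (G ∩ T)) 𝒢

CoveringNumber : ∀ {N} → Family N → ℕ → Set
CoveringNumber {N} 𝒢 t =
  (Σ (Subset N) λ T → ∣ T ∣ ≡ t × IsCover 𝒢 T)
  × (∀ T → IsCover 𝒢 T → t ≤ ∣ T ∣)

disjointCount : ∀ {N} → Family N → Subset N → ℕ
disjointCount 𝒢 S = length (filter (λ G → ¬? (nonempty? (G ∩ S))) 𝒢)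

{-# OPTIONS --safe #-}
module Submission where

-- Take three disjoint copies of the 2-(6,3,2) design (ten triples on six points, any two of
-- which meet) and let 𝒢 consist of the unions of two members from two different copies.
-- Two members of 𝒢 use two pairs of copies out of three, so they share a copy and meet there.
-- If a set S meets the copies in S₀, S₁, S₂ and cᵢ triples of the design avoid Sᵢ, then exactly
-- c₀c₁ + c₀c₂ + c₁c₂ members of 𝒢 avoid S. Since the design is a 2-design, cᵢ ≥ 10, 5, 2 when
-- |Sᵢ| = 0, 1, 2, and every split of |S| ≤ 5 then leaves at least 20 members avoiding S;
-- in particular no set of at most five points covers 𝒢, so τ(𝒢) = 6.

open import Defs
open import Data.Bool using (_∧_)
open import Data.Bool.Properties using () renaming (_≟_ to _≟ᵇ_)
open import Data.Fin using (Fin; zero; suc)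
open import Data.Fin.Patterns using (0F; 1F; 2F; 3F; 4F; 5F)
open import Data.Fin.Subset using (Subset; inside; outside; ⊥; ⁅_⁆; _∪_; _∩_; ∣_∣; Nonempty; Empty)
open import Data.Fin.Subset.Properties using (nonempty?; anySubset?; ∉⊥; ∣⊥∣≡0; ∩-zeroˡ)
open import Data.List using ([]; _∷_; [_]; _++_; map; filter; length; cartesianProductWith)
open import Data.List.Properties
  using (filter-++; length-++; filter-accept; filter-reject; filter-none)
open import Data.List.Membership.Propositional using (_∈_)
open import Data.List.Membership.Propositional.Properties
  using (∈-++⁺ˡ; ∈-++⁻; ∈-cartesianProductWith⁺; ∈-cartesianProductWith⁻)
open import Data.List.Relation.Unary.All as All using (All; []; _∷_; all?)
import Data.List.Relation.Unary.All.Properties as All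
open import Data.List.Relation.Unary.AllPairs using ([]; _∷_; allPairs?)
open import Data.List.Relation.Unary.Any using (here; there)
open import Data.List.Relation.Unary.Unique.Propositional using (Unique)
import Data.List.Relation.Unary.Unique.Propositional.Properties as Unique
open import Data.List.Relation.Binary.Disjoint.Propositional using (Disjoint)
open import Data.Nat using (ℕ; suc; _+_; _*_; _≤_; _<_; _≤?_; _≟_; z≤n; s≤s; s≤s⁻¹)
open import Data.Nat.Properties
  using ( ≤-reflexive; <-≤-trans; ≮⇒≥; n≮0; m+n≤o⇒m≤o; m+n≤o⇒n≤o; +-mono-≤; *-mono-≤; +-identityʳ
        ; allUpTo?; module ≤-Reasoning)
open import Data.Nat.Tactic.RingSolver using (solve-∀)
open import Data.Product as Product using (Σ; ∃₂; _×_; _,_; proj₁; proj₂)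
open import Data.Sum as Sum using (_⊎_; inj₁; inj₂)
open import Data.Vec using ([]; _∷_; here; there; splitAt) renaming (_++_ to _++ᵛ_)
open import Data.Vec.Properties
  using (zipWith-++; ++-injective; ++-injectiveˡ; ++-injectiveʳ; ≡-dec)
open import Function using (_∘_; case_of_; _⇔_; mk⇔; Equivalence)
open import Relation.Nullary using (Dec; yes; no; ¬?)
open import Relation.Nullary.Decidable using (from-yes; map′; decidable-stable; _→-dec_)
open import Relation.Unary using (Pred; Decidable)
open import Relation.Binary.PropositionalEquality
  using (_≡_; refl; sym; trans; cong; cong₂; subst; module ≡-Reasoning)

open Equivalence using (to; from)

∣p++q∣≡∣p∣+∣q∣ : ∀ {m n} (p : Subset m) (q : Subset n) → ∣ p ++ᵛ q ∣ ≡ ∣ p ∣ + ∣ q ∣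
∣p++q∣≡∣p∣+∣q∣ []            q = refl
∣p++q∣≡∣p∣+∣q∣ (inside  ∷ p) q = cong suc (∣p++q∣≡∣p∣+∣q∣ p q)
∣p++q∣≡∣p∣+∣q∣ (outside ∷ p) q = ∣p++q∣≡∣p∣+∣q∣ p q

∩-++ : ∀ {m n} (p : Subset m) (q : Subset n) (r : Subset m) (s : Subset n) →
       (p ++ᵛ q) ∩ (r ++ᵛ s) ≡ (p ∩ r) ++ᵛ (q ∩ s)
∩-++ = zipWith-++ _∧_

Nonempty-++⁺ˡ : ∀ {m n} {p : Subset m} (q : Subset n) → Nonempty p → Nonempty (p ++ᵛ q)
Nonempty-++⁺ˡ q (zero  , here)      = zero , here
Nonempty-++⁺ˡ q (suc i , there i∈p) = Product.map suc there (Nonempty-++⁺ˡ q (i , i∈p))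

Nonempty-++⁺ʳ : ∀ {m n} (p : Subset m) {q : Subset n} → Nonempty q → Nonempty (p ++ᵛ q)
Nonempty-++⁺ʳ []      q≢∅ = q≢∅
Nonempty-++⁺ʳ (_ ∷ p) q≢∅ = Product.map suc there (Nonempty-++⁺ʳ p q≢∅)

Nonempty-++⁻ : ∀ {m n} (p : Subset m) {q : Subset n} → Nonempty (p ++ᵛ q) → Nonempty p ⊎ Nonempty q
Nonempty-++⁻ []            p++q≢∅              = inj₂ p++q≢∅
Nonempty-++⁻ (inside  ∷ p) _                   = inj₁ (zero , here)
Nonempty-++⁻ (outside ∷ p) (suc i , there i∈) =
  Sum.map₁ (Product.map suc there) (Nonempty-++⁻ p (i , i∈))

Empty-++ : ∀ {m n} (p : Subset m) (q : Subset n) → Empty (p ++ᵛ q) ⇔ (Empty p × Empty q)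
Empty-++ p q = mk⇔ (λ p++q≡∅ → p++q≡∅ ∘ Nonempty-++⁺ˡ q , p++q≡∅ ∘ Nonempty-++⁺ʳ p)
                   (λ (p≡∅ , q≡∅) → Sum.[ p≡∅ , q≡∅ ] ∘ Nonempty-++⁻ p)

infixr 6 _⊗_

-- Opaque, so that unification recovers the sizes of the factors from a product.
opaque
  _⊗_ : ∀ {m n} → Family m → Family n → Family (m + n)
  𝒜 ⊗ ℬ = cartesianProductWith _++ᵛ_ 𝒜 ℬ

opaque
  unfolding _⊗_

  ∈-⊗⁻ : ∀ {m n} (𝒜 : Family m) (ℬ : Family n) {G} → G ∈ 𝒜 ⊗ ℬ →
         ∃₂ λ A B → A ∈ 𝒜 × B ∈ ℬ × G ≡ A ++ᵛ B
  ∈-⊗⁻ = ∈-cartesianProductWith⁻ _++ᵛ_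

  ∈-⊗⁺ : ∀ {m n} {𝒜 : Family m} {ℬ : Family n} {A B} → A ∈ 𝒜 → B ∈ ℬ → A ++ᵛ B ∈ 𝒜 ⊗ ℬ
  ∈-⊗⁺ = ∈-cartesianProductWith⁺ _++ᵛ_

  Unique-⊗ : ∀ {m n} {𝒜 : Family m} {ℬ : Family n} → Unique 𝒜 → Unique ℬ → Unique (𝒜 ⊗ ℬ)
  Unique-⊗ = Unique.cartesianProductWith⁺ _++ᵛ_ (λ {A} {A′} → ++-injective A A′)

twoOfThree : ∀ {n} → Family n → Family (n + (n + n))
twoOfThree {n} 𝒦 = 𝒦 ⊗ 𝒦 ⊗ [ ⊥ {n} ] ++ 𝒦 ⊗ [ ⊥ {n} ] ⊗ 𝒦 ++ [ ⊥ {n} ] ⊗ 𝒦 ⊗ 𝒦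

Uniform-⊗ : ∀ {m n a b} {𝒜 : Family m} {ℬ : Family n} →
            Uniform a 𝒜 → Uniform b ℬ → Uniform (a + b) (𝒜 ⊗ ℬ)
Uniform-⊗ {𝒜 = 𝒜} {ℬ} ∣𝒜∣≡a ∣ℬ∣≡b = All.tabulate λ G∈ → case ∈-⊗⁻ 𝒜 ℬ G∈ of λ where
  (A , B , A∈ , B∈ , refl) →
    trans (∣p++q∣≡∣p∣+∣q∣ A B) (cong₂ _+_ (All.lookup ∣𝒜∣≡a A∈) (All.lookup ∣ℬ∣≡b B∈))

twoOfThree-uniform : ∀ {n k} {𝒦 : Family n} → Uniform k 𝒦 → Uniform (k + k) (twoOfThree 𝒦)
twoOfThree-uniform {n} {k} ∣𝒦∣≡k =
  All.++⁺ (All.map (λ ∣G∣≡ → trans ∣G∣≡ (cong (k +_) (+-identityʳ k)))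
                   (Uniform-⊗ ∣𝒦∣≡k (Uniform-⊗ ∣𝒦∣≡k ∅-uniform)))
  (All.++⁺ (Uniform-⊗ ∣𝒦∣≡k (Uniform-⊗ ∅-uniform ∣𝒦∣≡k))
           (Uniform-⊗ ∅-uniform (Uniform-⊗ ∣𝒦∣≡k ∣𝒦∣≡k)))
  where
  ∅-uniform : Uniform 0 [ ⊥ {n} ]
  ∅-uniform = ∣⊥∣≡0 n ∷ []

Disjoint-⊗ˡ : ∀ {m n} {𝒜 𝒜′ : Family m} {ℬ ℬ′ : Family n} →
              Disjoint 𝒜 𝒜′ → Disjoint (𝒜 ⊗ ℬ) (𝒜′ ⊗ ℬ′)
Disjoint-⊗ˡ {𝒜 = 𝒜} {𝒜′} {ℬ} {ℬ′} 𝒜#𝒜′ (G∈ , G∈′)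
  with ∈-⊗⁻ 𝒜 ℬ G∈ | ∈-⊗⁻ 𝒜′ ℬ′ G∈′
... | A , _ , A∈ , _ , refl | A′ , _ , A′∈ , _ , A++B≡A′++B′ =
  𝒜#𝒜′ (A∈ , subst (_∈ 𝒜′) (sym (++-injectiveˡ A A′ A++B≡A′++B′)) A′∈)

Disjoint-⊗ʳ : ∀ {m n} {𝒜 𝒜′ : Family m} {ℬ ℬ′ : Family n} →
              Disjoint ℬ ℬ′ → Disjoint (𝒜 ⊗ ℬ) (𝒜′ ⊗ ℬ′)
Disjoint-⊗ʳ {𝒜 = 𝒜} {𝒜′} {ℬ} {ℬ′} ℬ#ℬ′ (G∈ , G∈′)
  with ∈-⊗⁻ 𝒜 ℬ G∈ | ∈-⊗⁻ 𝒜′ ℬ′ G∈′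
... | A , B , _ , B∈ , refl | A′ , B′ , _ , B′∈ , A++B≡A′++B′ =
  ℬ#ℬ′ (B∈ , subst (_∈ ℬ′) (sym (++-injectiveʳ A A′ A++B≡A′++B′)) B′∈)

Disjoint-++ʳ : ∀ {N} {𝒜 ℬ 𝒞 : Family N} → Disjoint 𝒜 ℬ → Disjoint 𝒜 𝒞 → Disjoint 𝒜 (ℬ ++ 𝒞)
Disjoint-++ʳ {ℬ = ℬ} 𝒜#ℬ 𝒜#𝒞 (G∈𝒜 , G∈ℬ++𝒞) =
  Sum.[ (λ G∈ℬ → 𝒜#ℬ (G∈𝒜 , G∈ℬ)) , (λ G∈𝒞 → 𝒜#𝒞 (G∈𝒜 , G∈𝒞)) ] (∈-++⁻ ℬ G∈ℬ++𝒞)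

Disjoint-[⊥] : ∀ {n} {𝒦 : Family n} → All Nonempty 𝒦 → Disjoint 𝒦 [ ⊥ ]
Disjoint-[⊥] 𝒦≢∅ (G∈ , here refl) = ∉⊥ (proj₂ (All.lookup 𝒦≢∅ G∈))

twoOfThree-unique : ∀ {n} {𝒦 : Family n} → Unique 𝒦 → All Nonempty 𝒦 → Unique (twoOfThree 𝒦)
twoOfThree-unique {n} {𝒦} u 𝒦≢∅ =
  Unique.++⁺ (Unique-⊗ u (Unique-⊗ u ∅-unique))
             (Unique.++⁺ (Unique-⊗ u (Unique-⊗ ∅-unique u))
                         (Unique-⊗ ∅-unique (Unique-⊗ u u))
                         02#12)
             (Disjoint-++ʳ 01#02 01#12)
  where
  ∅-unique : Unique [ ⊥ {n} ]
  ∅-unique = [] ∷ []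
  𝒦#∅ : Disjoint 𝒦 [ ⊥ ]
  𝒦#∅ = Disjoint-[⊥] 𝒦≢∅
  01#02 : Disjoint (𝒦 ⊗ 𝒦 ⊗ [ ⊥ ]) (𝒦 ⊗ [ ⊥ ] ⊗ 𝒦)
  01#02 = Disjoint-⊗ʳ (Disjoint-⊗ˡ 𝒦#∅)
  01#12 : Disjoint (𝒦 ⊗ 𝒦 ⊗ [ ⊥ ]) ([ ⊥ {n} ] ⊗ 𝒦 ⊗ 𝒦)
  01#12 = Disjoint-⊗ˡ 𝒦#∅
  02#12 : Disjoint (𝒦 ⊗ [ ⊥ ] ⊗ 𝒦) ([ ⊥ {n} ] ⊗ 𝒦 ⊗ 𝒦)
  02#12 = Disjoint-⊗ˡ 𝒦#∅

CrossIntersecting : ∀ {N} → Family N → Family N → Set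
CrossIntersecting 𝒜 ℬ = ∀ {A B} → A ∈ 𝒜 → B ∈ ℬ → Nonempty (A ∩ B)

CrossIntersecting-++ˡ : ∀ {N} {𝒜 ℬ 𝒞 : Family N} →
  CrossIntersecting 𝒜 𝒞 → CrossIntersecting ℬ 𝒞 → CrossIntersecting (𝒜 ++ ℬ) 𝒞
CrossIntersecting-++ˡ {𝒜 = 𝒜} 𝒜⋈𝒞 ℬ⋈𝒞 G∈ H∈ =
  Sum.[ (λ G∈𝒜 → 𝒜⋈𝒞 G∈𝒜 H∈) , (λ G∈ℬ → ℬ⋈𝒞 G∈ℬ H∈) ] (∈-++⁻ 𝒜 G∈)

CrossIntersecting-++ʳ : ∀ {N} {𝒜 ℬ 𝒞 : Family N} →
  CrossIntersecting 𝒜 ℬ → CrossIntersecting 𝒜 𝒞 → CrossIntersecting 𝒜 (ℬ ++ 𝒞)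
CrossIntersecting-++ʳ {ℬ = ℬ} 𝒜⋈ℬ 𝒜⋈𝒞 G∈ H∈ =
  Sum.[ (λ H∈ℬ → 𝒜⋈ℬ G∈ H∈ℬ) , (λ H∈𝒞 → 𝒜⋈𝒞 G∈ H∈𝒞) ] (∈-++⁻ ℬ H∈)

CrossIntersecting-⊗ˡ : ∀ {m n} {𝒜 𝒜′ : Family m} {ℬ ℬ′ : Family n} →
  CrossIntersecting 𝒜 𝒜′ → CrossIntersecting (𝒜 ⊗ ℬ) (𝒜′ ⊗ ℬ′)
CrossIntersecting-⊗ˡ {𝒜 = 𝒜} {𝒜′} {ℬ} {ℬ′} 𝒜⋈𝒜′ G∈ H∈
  with ∈-⊗⁻ 𝒜 ℬ G∈ | ∈-⊗⁻ 𝒜′ ℬ′ H∈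
... | A , B , A∈ , _ , refl | A′ , B′ , A′∈ , _ , refl =
  subst Nonempty (sym (∩-++ A B A′ B′)) (Nonempty-++⁺ˡ (B ∩ B′) (𝒜⋈𝒜′ A∈ A′∈))

CrossIntersecting-⊗ʳ : ∀ {m n} {𝒜 𝒜′ : Family m} {ℬ ℬ′ : Family n} →
  CrossIntersecting ℬ ℬ′ → CrossIntersecting (𝒜 ⊗ ℬ) (𝒜′ ⊗ ℬ′)
CrossIntersecting-⊗ʳ {𝒜 = 𝒜} {𝒜′} {ℬ} {ℬ′} ℬ⋈ℬ′ G∈ H∈
  with ∈-⊗⁻ 𝒜 ℬ G∈ | ∈-⊗⁻ 𝒜′ ℬ′ H∈
... | A , B , _ , B∈ , refl | A′ , B′ , _ , B′∈ , refl =
  subst Nonempty (sym (∩-++ A B A′ B′)) (Nonempty-++⁺ʳ (A ∩ A′) (ℬ⋈ℬ′ B∈ B′∈))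

twoOfThree-intersecting : ∀ {n} {𝒦 : Family n} → Intersecting 𝒦 → Intersecting (twoOfThree 𝒦)
twoOfThree-intersecting {n} {𝒦} 𝒦⋈𝒦 =
  CrossIntersecting-++ˡ (CrossIntersecting-++ʳ meet₀ (CrossIntersecting-++ʳ meet₀ meet₁))
  (CrossIntersecting-++ˡ (CrossIntersecting-++ʳ meet₀ (CrossIntersecting-++ʳ meet₀ meet₂))
                         (CrossIntersecting-++ʳ meet₁ (CrossIntersecting-++ʳ meet₂ meet₁)))
  where
  meet₀ : ∀ {ℬ ℬ′ : Family (n + n)} → CrossIntersecting (𝒦 ⊗ ℬ) (𝒦 ⊗ ℬ′)
  meet₀ = CrossIntersecting-⊗ˡ 𝒦⋈𝒦
  meet₁ : ∀ {𝒜 𝒜′ : Family n} {𝒞 𝒞′ : Family n} → CrossIntersecting (𝒜 ⊗ 𝒦 ⊗ 𝒞) (𝒜′ ⊗ 𝒦 ⊗ 𝒞′)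
  meet₁ = CrossIntersecting-⊗ʳ (CrossIntersecting-⊗ˡ 𝒦⋈𝒦)
  meet₂ : ∀ {𝒜 𝒜′ ℬ ℬ′ : Family n} → CrossIntersecting (𝒜 ⊗ ℬ ⊗ 𝒦) (𝒜′ ⊗ ℬ′ ⊗ 𝒦)
  meet₂ = CrossIntersecting-⊗ʳ (CrossIntersecting-⊗ʳ 𝒦⋈𝒦)

module _ {a b c p q r} {A : Set a} {B : Set b} {C : Set c}
         {P : Pred A p} {Q : Pred B q} {R : Pred C r}
         (P? : Decidable P) (Q? : Decidable Q) (R? : Decidable R) where

  length-filter-map : ∀ {g : B → C} → (∀ y → R (g y) ⇔ Q y) →
                      ∀ ys → length (filter R? (map g ys)) ≡ length (filter Q? ys)
  length-filter-map R∘g⇔Q []       = refl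
  length-filter-map R∘g⇔Q (y ∷ ys) with Q? y
  ... | yes Qy = trans (cong length (filter-accept R? (from (R∘g⇔Q y) Qy)))
                       (cong suc (length-filter-map R∘g⇔Q ys))
  ... | no ¬Qy = trans (cong length (filter-reject R? (¬Qy ∘ to (R∘g⇔Q y))))
                       (length-filter-map R∘g⇔Q ys)

  length-filter-cartesianProductWith :
    ∀ {f : A → B → C} → (∀ x y → R (f x y) ⇔ (P x × Q y)) → ∀ xs ys →
    length (filter R? (cartesianProductWith f xs ys))
      ≡ length (filter P? xs) * length (filter Q? ys)
  length-filter-cartesianProductWith R∘f⇔P×Q [] ys = refl
  length-filter-cartesianProductWith {f} R∘f⇔P×Q (x ∷ xs) ys
    rewrite filter-++ R? (map (f x) ys) (cartesianProductWith f xs ys)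
          | length-++ (filter R? (map (f x) ys)) {filter R? (cartesianProductWith f xs ys)}
          | length-filter-cartesianProductWith R∘f⇔P×Q xs ys
    with P? x
  ... | yes Px = cong (_+ _) (length-filter-map
                   (λ y → mk⇔ (proj₂ ∘ to (R∘f⇔P×Q x y)) (λ Qy → from (R∘f⇔P×Q x y) (Px , Qy))) ys)
  ... | no ¬Px = cong (λ k → length k + _) (filter-none R? (All.map⁺
                   (All.universal (λ y → ¬Px ∘ proj₁ ∘ to (R∘f⇔P×Q x y)) ys)))

avoids? : ∀ {N} (S : Subset N) → Decidable (λ G → Empty (G ∩ S))
avoids? S G = ¬? (nonempty? (G ∩ S))

disjointCount-++ : ∀ {N} (𝒜 ℬ : Family N) S →
                   disjointCount (𝒜 ++ ℬ) S ≡ disjointCount 𝒜 S + disjointCount ℬ S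
disjointCount-++ 𝒜 ℬ S =
  trans (cong length (filter-++ (avoids? S) 𝒜 ℬ)) (length-++ (filter (avoids? S) 𝒜))

disjointCount-[⊥] : ∀ {n} (S : Subset n) → disjointCount [ ⊥ ] S ≡ 1
disjointCount-[⊥] S =
  cong length (filter-accept (avoids? S) (∉⊥ ∘ proj₂ ∘ subst Nonempty (∩-zeroˡ S)))

opaque
  unfolding _⊗_

  disjointCount-⊗ : ∀ {m n} (𝒜 : Family m) (ℬ : Family n) S T →
                    disjointCount (𝒜 ⊗ ℬ) (S ++ᵛ T) ≡ disjointCount 𝒜 S * disjointCount ℬ T
  disjointCount-⊗ 𝒜 ℬ S T =
    length-filter-cartesianProductWith (avoids? S) (avoids? T) (avoids? (S ++ᵛ T)) avoids-++ 𝒜 ℬ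
    where
    avoids-++ : ∀ A B → Empty ((A ++ᵛ B) ∩ (S ++ᵛ T)) ⇔ (Empty (A ∩ S) × Empty (B ∩ T))
    avoids-++ A B rewrite ∩-++ A B S T = Empty-++ (A ∩ S) (B ∩ T)

σ₂ : ℕ → ℕ → ℕ → ℕ
σ₂ a b c = a * b + a * c + b * c

σ₂-mono-≤ : ∀ {a a′ b b′ c c′} → a ≤ a′ → b ≤ b′ → c ≤ c′ → σ₂ a b c ≤ σ₂ a′ b′ c′
σ₂-mono-≤ a≤a′ b≤b′ c≤c′ =
  +-mono-≤ (+-mono-≤ (*-mono-≤ a≤a′ b≤b′) (*-mono-≤ a≤a′ c≤c′)) (*-mono-≤ b≤b′ c≤c′)

disjointCount-twoOfThree : ∀ {n} (𝒦 : Family n) S₀ S₁ S₂ →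
  disjointCount (twoOfThree 𝒦) (S₀ ++ᵛ (S₁ ++ᵛ S₂))
    ≡ σ₂ (disjointCount 𝒦 S₀) (disjointCount 𝒦 S₁) (disjointCount 𝒦 S₂)
disjointCount-twoOfThree {n} 𝒦 S₀ S₁ S₂ = begin
  disjointCount (b₀₁ ++ b₀₂ ++ b₁₂) S
    ≡⟨ disjointCount-++ b₀₁ (b₀₂ ++ b₁₂) S ⟩
  disjointCount b₀₁ S + disjointCount (b₀₂ ++ b₁₂) S
    ≡⟨ cong (disjointCount b₀₁ S +_) (disjointCount-++ b₀₂ b₁₂ S) ⟩
  disjointCount b₀₁ S + (disjointCount b₀₂ S + disjointCount b₁₂ S)
    ≡⟨ cong₂ _+_ (⊗³ 𝒦 𝒦 [ ⊥ ]) (cong₂ _+_ (⊗³ 𝒦 [ ⊥ ] 𝒦) (⊗³ [ ⊥ ] 𝒦 𝒦)) ⟩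
  c₀ * (c₁ * ∅₂) + (c₀ * (∅₁ * c₂) + ∅₀ * (c₁ * c₂))
    ≡⟨ cong₂ _+_ (cong (λ x → c₀ * (c₁ * x)) (disjointCount-[⊥] S₂))
                 (cong₂ _+_ (cong (λ x → c₀ * (x * c₂)) (disjointCount-[⊥] S₁))
                            (cong (_* (c₁ * c₂)) (disjointCount-[⊥] S₀))) ⟩
  c₀ * (c₁ * 1) + (c₀ * (1 * c₂) + 1 * (c₁ * c₂))
    ≡⟨ unit-elimination c₀ c₁ c₂ ⟩
  σ₂ c₀ c₁ c₂ ∎
  where
  open ≡-Reasoning
  S : Subset (n + (n + n))
  S = S₀ ++ᵛ (S₁ ++ᵛ S₂)
  b₀₁ b₀₂ b₁₂ : Family (n + (n + n))
  b₀₁ = 𝒦 ⊗ 𝒦 ⊗ [ ⊥ ]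
  b₀₂ = 𝒦 ⊗ [ ⊥ ] ⊗ 𝒦
  b₁₂ = [ ⊥ {n} ] ⊗ 𝒦 ⊗ 𝒦
  c₀ c₁ c₂ ∅₀ ∅₁ ∅₂ : ℕ
  c₀ = disjointCount 𝒦 S₀
  c₁ = disjointCount 𝒦 S₁
  c₂ = disjointCount 𝒦 S₂
  ∅₀ = disjointCount [ ⊥ ] S₀
  ∅₁ = disjointCount [ ⊥ ] S₁
  ∅₂ = disjointCount [ ⊥ ] S₂
  ⊗³ : ∀ (𝒜 ℬ 𝒞 : Family n) →
       disjointCount (𝒜 ⊗ ℬ ⊗ 𝒞) S ≡ disjointCount 𝒜 S₀ * (disjointCount ℬ S₁ * disjointCount 𝒞 S₂)
  ⊗³ 𝒜 ℬ 𝒞 = trans (disjointCount-⊗ 𝒜 (ℬ ⊗ 𝒞) S₀ (S₁ ++ᵛ S₂))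
                   (cong (disjointCount 𝒜 S₀ *_) (disjointCount-⊗ ℬ 𝒞 S₁ S₂))
  unit-elimination : ∀ a b c → a * (b * 1) + (a * (1 * c) + 1 * (b * c)) ≡ a * b + a * c + b * c
  unit-elimination = solve-∀

disjointCount-cover : ∀ {N} (𝒢 : Family N) {T} → IsCover 𝒢 T → disjointCount 𝒢 T ≡ 0
disjointCount-cover 𝒢 {T} T-covers =
  cong length (filter-none (avoids? T) (All.map (λ meets avoids → avoids meets) T-covers))

CoveringNumber-uniform : ∀ {N k} {𝒢 : Family N} {G} → Intersecting 𝒢 → Uniform k 𝒢 → G ∈ 𝒢 →
  (∀ S → ∣ S ∣ < k → 0 < disjointCount 𝒢 S) → CoveringNumber 𝒢 k
CoveringNumber-uniform {𝒢 = 𝒢} {G} 𝒢⋈𝒢 ∣𝒢∣≡k G∈ small-misses =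
  (G , All.lookup ∣𝒢∣≡k G∈ , All.tabulate (λ H∈ → 𝒢⋈𝒢 H∈ G∈)) ,
  λ T T-covers → ≮⇒≥ λ ∣T∣<k →
    n≮0 (subst (0 <_) (disjointCount-cover 𝒢 T-covers) (small-misses T ∣T∣<k))

allSubsets? : ∀ {n ℓ} {P : Pred (Subset n) ℓ} → Decidable P → Dec (∀ s → P s)
allSubsets? P? = map′ (λ ∄¬P s → decidable-stable (P? s) (∄¬P ∘ (s ,_)))
                      (λ ∀P (s , ¬Ps) → ¬Ps (∀P s))
                      (¬? (anySubset? (¬? ∘ P?)))

intersecting? : ∀ {N} (𝒢 : Family N) → Dec (Intersecting 𝒢)
intersecting? 𝒢 = map′ (λ meet G∈ H∈ → All.lookup (All.lookup meet G∈) H∈)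
                       (λ 𝒢⋈𝒢 → All.tabulate λ G∈ → All.tabulate λ H∈ → 𝒢⋈𝒢 G∈ H∈)
                       (all? (λ G → all? (λ H → nonempty? (G ∩ H)) 𝒢) 𝒢)

triple : Fin 6 → Fin 6 → Fin 6 → Subset 6
triple i j k = ⁅ i ⁆ ∪ ⁅ j ⁆ ∪ ⁅ k ⁆

-- The 2-(6,3,2) design: every pair of points lies in exactly two of these ten triples.
design : Family 6
design =
  triple 2F 4F 5F ∷ triple 0F 1F 5F ∷ triple 1F 3F 5F ∷ triple 0F 3F 4F ∷ triple 0F 2F 3F ∷
  triple 2F 3F 5F ∷ triple 1F 3F 4F ∷ triple 0F 1F 2F ∷ triple 0F 4F 5F ∷ triple 1F 2F 4F ∷ []

design-unique : Unique design
design-unique = from-yes (allPairs? (λ G H → ¬? (≡-dec _≟ᵇ_ G H)) design)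

design-nonempty : All Nonempty design
design-nonempty = from-yes (all? nonempty? design)

design-uniform : Uniform 3 design
design-uniform = from-yes (all? (λ G → ∣ G ∣ ≟ 3) design)

design-intersecting : Intersecting design
design-intersecting = from-yes (intersecting? design)

-- By inclusion–exclusion over the design, 10, 10 − 5 and 10 − 2·5 + 2 triples avoid
-- a set of 0, 1 and 2 points respectively.
minAvoiding : ℕ → ℕ
minAvoiding 0 = 10
minAvoiding 1 = 5
minAvoiding 2 = 2
minAvoiding _ = 0

minAvoiding-≤-disjointCount : ∀ s → minAvoiding ∣ s ∣ ≤ disjointCount design s
minAvoiding-≤-disjointCount =
  from-yes (allSubsets? λ s → minAvoiding ∣ s ∣ ≤? disjointCount design s)

20≤σ₂-minAvoiding : ∀ x y z → x + (y + z) ≤ 5 →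
                    20 ≤ σ₂ (minAvoiding x) (minAvoiding y) (minAvoiding z)
20≤σ₂-minAvoiding x y z x+y+z≤5 = from-yes bounded x<6 y<6 z<6 x+y+z≤5
  where
  y+z≤5 : y + z ≤ 5
  y+z≤5 = m+n≤o⇒n≤o x x+y+z≤5
  x<6 : x < 6
  x<6 = s≤s (m+n≤o⇒m≤o x x+y+z≤5)
  y<6 : y < 6
  y<6 = s≤s (m+n≤o⇒m≤o y y+z≤5)
  z<6 : z < 6
  z<6 = s≤s (m+n≤o⇒n≤o y y+z≤5)
  bounded : Dec (∀ {x} → x < 6 → ∀ {y} → y < 6 → ∀ {z} → z < 6 →
                 x + (y + z) ≤ 5 → 20 ≤ σ₂ (minAvoiding x) (minAvoiding y) (minAvoiding z))
  bounded = allUpTo? (λ x → allUpTo? (λ y → allUpTo? (λ z → (x + (y + z) ≤? 5) →-dec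
              (20 ≤? σ₂ (minAvoiding x) (minAvoiding y) (minAvoiding z))) 6) 6) 6

20≤disjointCount : ∀ S → ∣ S ∣ ≤ 5 → 20 ≤ disjointCount (twoOfThree design) S
20≤disjointCount S ∣S∣≤5 with splitAt 6 S
... | S₀ , R , refl with splitAt 6 R
... | S₁ , S₂ , refl = begin
  20
    ≤⟨ 20≤σ₂-minAvoiding (∣ S₀ ∣) (∣ S₁ ∣) (∣ S₂ ∣) (subst (_≤ 5) ∣S∣≡ ∣S∣≤5) ⟩
  σ₂ (minAvoiding ∣ S₀ ∣) (minAvoiding ∣ S₁ ∣) (minAvoiding ∣ S₂ ∣)
    ≤⟨ σ₂-mono-≤ (minAvoiding-≤-disjointCount S₀) (minAvoiding-≤-disjointCount S₁)
                 (minAvoiding-≤-disjointCount S₂) ⟩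
  σ₂ (disjointCount design S₀) (disjointCount design S₁) (disjointCount design S₂)
    ≡⟨ disjointCount-twoOfThree design S₀ S₁ S₂ ⟨
  disjointCount (twoOfThree design) (S₀ ++ᵛ (S₁ ++ᵛ S₂)) ∎
  where
  open ≤-Reasoning
  ∣S∣≡ : ∣ S₀ ++ᵛ (S₁ ++ᵛ S₂) ∣ ≡ ∣ S₀ ∣ + (∣ S₁ ∣ + ∣ S₂ ∣)
  ∣S∣≡ = trans (∣p++q∣≡∣p∣+∣q∣ S₀ (S₁ ++ᵛ S₂)) (cong (∣ S₀ ∣ +_) (∣p++q∣≡∣p∣+∣q∣ S₁ S₂))

proposition5p4 :
    Σ ℕ λ N → Σ (Family N) λ 𝒢 →
      Unique 𝒢 × Uniform 6 𝒢 × Intersecting 𝒢 × CoveringNumber 𝒢 6 ×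
      ((S : Subset N) → ∣ S ∣ ≡ 5 → 20 ≤ disjointCount 𝒢 S)
proposition5p4 =
  18 , twoOfThree design ,
  twoOfThree-unique design-unique design-nonempty ,
  𝒢-uniform , 𝒢-intersecting ,
  CoveringNumber-uniform 𝒢-intersecting 𝒢-uniform G∈𝒢
    (λ S ∣S∣<6 → <-≤-trans (s≤s z≤n) (20≤disjointCount S (s≤s⁻¹ ∣S∣<6))) ,
  λ S ∣S∣≡5 → 20≤disjointCount S (≤-reflexive ∣S∣≡5)
  where
  𝒢-uniform : Uniform 6 (twoOfThree design)
  𝒢-uniform = twoOfThree-uniform design-uniform
  𝒢-intersecting : Intersecting (twoOfThree design)
  𝒢-intersecting = twoOfThree-intersecting design-intersecting
  G∈𝒢 : triple 2F 4F 5F ++ᵛ (triple 2F 4F 5F ++ᵛ ⊥) ∈ twoOfThree design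
  G∈𝒢 = ∈-++⁺ˡ (∈-⊗⁺ (here refl) (∈-⊗⁺ (here refl) (here refl)))
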